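{- Let $S_1$ and $S$ be the calculi described in the context. Then: (a) for all terms $s,r$ and finite multisets $\Gamma,\Delta$, the sequent $s=r,\Gamma\Rightarrow\Delta$ is derivable in $S_1$ from the sequent $s=r,s=r,\Gamma\Rightarrow\Delta$ (i.e. the rule $\hbox{Contr}^=$ inferring the former from the latter is derivable in $S_1$); (b) for all terms $s,r$ and finite multisets $\Gamma,\Delta$, the sequent $r=s,\Gamma\Rightarrow\Delta$ is derivable from $s=r,\Gamma\Rightarrow\Delta$ using the rules of $S_1$ together with the left weakening rule (from $\Gamma\Rightarrow\Delta$ infer $F,\Gamma\Rightarrow\Delta$); the same holds for $S$ in place of $S_1$.
   Context: ${\bf G3[mic]}^=$ denotes any of the multisuccedent $\mathbf{G3}$-style sequent calculi (without structural rules) for minimal, intuitionistic or classical first-order logic over a language with function symbols and equality, in the style of Negri–von Plato: sequents $\Gamma\Rightarrow\Delta$ have finite multisets of formulas on both sides, with the usual initial sequents and logical rules, extended by the equality rules $\hbox{Ref}$: from $t=t,\Gamma\Rightarrow\Delta$ infer $\Gamma\Rightarrow\Delta$ (for any term $t$), and $\hbox{Repl}$: from $s=r, P[v/s], P[v/r],\Gamma\Rightarrow\Delta$ infer $s=r,P[v/s],\Gamma\Rightarrow\Delta$, where $P$ is atomic, $s,r$ are terms and the variable $v$ does not occur in $s,r$. $S={{\bf G3[mic]}^=}^-$ is obtained from ${\bf G3[mic]}^=$ by replacing $\hbox{Repl}$ with $\hbox{Repl}^-$: from $s=r, P[v/r],\Gamma\Rightarrow\Delta$ infer $s=r,P[v/s],\Gamma\Rightarrow\Delta$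 (same provisos). $S_1$ is obtained from $S$ by replacing $\hbox{Repl}^-$ with its restriction $\hbox{Repl}^-_1$ to instances in which $v$ has exactly one occurrence in $P$. $P[v/t]$ denotes substitution of the term $t$ for $v$ in $P$. -}

module Defs where

open import Data.Nat using (ℕ; zero; suc; _+_; _≟_)
open import Data.Fin using (Fin; zero; suc)
open import Data.Vec using (Vec; []; _∷_)
open import Data.List using (List; []; _∷_)
open import Data.Maybe using (Maybe; just; nothing)
open import Data.Product using (_×_; _,_)
open import Data.Unit using (⊤)
open import Data.Empty using (⊥)
open import Relation.Nullary using (yes; no)
open import Relation.Binary.PropositionalEquality using (_≡_)
open import Data.List.Relation.Binary.Permutation.Propositional using (_↭_)

-- First-order signature: function symbols and predicate symbols with
-- arities (equality is built in as a logical atom).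

record Sig : Set₁ where
  field
    Fun    : Set
    funAr  : Fun → ℕ
    Rel    : Set
    relAr  : Rel → ℕ

data Logic : Set where
  minimal intuitionistic classical : Logic

data ReplKind : Set where
  Repl     : ReplKind   -- original  G3[mic]^=
  Repl⁻    : ReplKind   -- S  = G3[mic]^=⁻
  Repl⁻₁   : ReplKind   -- S₁ (Repl⁻ restricted to exactly one occurrence of v)

data Weak : Set where
  noLW withLW : Weak

IsClassical NonClassical : Logic → Set
IsClassical classical = ⊤
IsClassical _         = ⊥
NonClassical classical = ⊥
NonClassical _         = ⊤

IsFull IsMinus : ReplKind → Set
IsFull Repl = ⊤
IsFull _    = ⊥
IsMinus Repl = ⊥
IsMinus _    = ⊤

lowerTop : ∀ {k} → Fin (suc k) → Maybe (Fin k)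
lowerTop {zero}  zero    = nothing
lowerTop {suc k} zero    = just zero
lowerTop {suc k} (suc i) with lowerTop {k} i
... | just j  = just (suc j)
... | nothing = nothing

module _ (σ : Sig) where
  open Sig σ

  -- Syntax, locally nameless: free variables are named by ℕ, bound
  -- variables are well-scoped de Bruijn indices (Term n has n bound
  -- variables in scope).  Sequents contain only Formula 0.

  data Term (n : ℕ) : Set where
    var  : ℕ → Term n
    bvar : Fin n → Term n
    fun  : (f : Fun) → Vec (Term n) (funAr f) → Term n

  data Atom (n : ℕ) : Set where
    rel  : (p : Rel) → Vec (Term n) (relAr p) → Atom n
    _≐_  : Term n → Term n → Atom n

  data Formula (n : ℕ) : Set where
    atom      : Atom n → Formula n
    ⊥'        : Formula n
    _∧'_ _∨'_ _⊃'_ : Formula n → Formula n → Formula n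
    ∀' ∃'     : Formula (suc n) → Formula n

  mutual
    occT : ∀ {n} → ℕ → Term n → ℕ
    occT v (var x) with v ≟ x
    ... | yes _ = 1
    ... | no  _ = 0
    occT v (bvar _)   = 0
    occT v (fun f ts) = occTs v ts

    occTs : ∀ {n m} → ℕ → Vec (Term n) m → ℕ
    occTs v []       = 0
    occTs v (t ∷ ts) = occT v t + occTs v ts

  occA : ∀ {n} → ℕ → Atom n → ℕ
  occA v (rel p ts) = occTs v ts
  occA v (s ≐ r)    = occT v s + occT v r

  occF : ∀ {n} → ℕ → Formula n → ℕ
  occF v (atom a)  = occA v a
  occF v ⊥'        = 0
  occF v (A ∧' B)  = occF v A + occF v B
  occF v (A ∨' B)  = occF v A + occF v B
  occF v (A ⊃' B)  = occF v A + occF v B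
  occF v (∀' A)    = occF v A
  occF v (∃' A)    = occF v A

  occL : ℕ → List (Formula 0) → ℕ
  occL v []       = 0
  occL v (A ∷ Γ)  = occF v A + occL v Γ

  mutual
    substT : ℕ → Term 0 → Term 0 → Term 0
    substT v t (var x) with v ≟ x
    ... | yes _ = t
    ... | no  _ = var x
    substT v t (bvar ())
    substT v t (fun f ts) = fun f (substTs v t ts)

    substTs : ∀ {m} → ℕ → Term 0 → Vec (Term 0) m → Vec (Term 0) m
    substTs v t []       = []
    substTs v t (u ∷ us) = substT v t u ∷ substTs v t us

  _[_/_] : Atom 0 → ℕ → Term 0 → Atom 0
  rel p ts [ v / t ] = rel p (substTs v t ts)
  (a ≐ b)  [ v / t ] = substT v t a ≐ substT v t b

  -- instantiation of the outermost bound variable by a term t : A(t/x)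
  -- (at depth n the outermost bound variable is the largest index)

  mutual
    embT : ∀ {n} → Term 0 → Term n
    embT (var x)    = var x
    embT (bvar ())
    embT (fun f ts) = fun f (embTs ts)

    embTs : ∀ {n m} → Vec (Term 0) m → Vec (Term n) m
    embTs []       = []
    embTs (u ∷ us) = embT u ∷ embTs us

  mutual
    instT : ∀ {n} → Term (suc n) → Term 0 → Term n
    instT (var x)    t = var x
    instT (bvar i)   t with lowerTop i
    ... | just j  = bvar j
    ... | nothing = embT t
    instT (fun f ts) t = fun f (instTs ts t)

    instTs : ∀ {n m} → Vec (Term (suc n)) m → Term 0 → Vec (Term n) m
    instTs []       t = []
    instTs (u ∷ us) t = instT u t ∷ instTs us t

  instA : ∀ {n} → Atom (suc n) → Term 0 → Atom n
  instA (rel p ts) t = rel p (instTs ts t)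
  instA (a ≐ b)    t = instT a t ≐ instT b t

  inst : ∀ {n} → Formula (suc n) → Term 0 → Formula n
  inst (atom a) t  = atom (instA a t)
  inst ⊥' t        = ⊥'
  inst (A ∧' B) t  = inst A t ∧' inst B t
  inst (A ∨' B) t  = inst A t ∨' inst B t
  inst (A ⊃' B) t  = inst A t ⊃' inst B t
  inst (∀' A) t    = ∀' (inst A t)
  inst (∃' A) t    = ∃' (inst A t)

  -- Sequents: pairs of lists, read as multisets (derivations are closed
  -- under permutation of either side, see `perm` below).

  infix 4 _⇒_
  record Seq : Set where
    constructor _⇒_
    field
      ante succ : List (Formula 0)

  eqF : Term 0 → Term 0 → Formula 0
  eqF s r = atom (s ≐ r)

  -- formulas allowed as principal formulas of initial sequents
  -- (atomic formulas; in minimal logic ⊥ is an ordinary propositional atom)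
  InitFormula : Logic → Formula 0 → Set
  InitFormula L (atom a)       = ⊤
  InitFormula minimal ⊥'       = ⊤
  InitFormula _ _              = ⊥

  HasL⊥ : Logic → Set
  HasL⊥ minimal = ⊥
  HasL⊥ _       = ⊤

  ReplCond : ReplKind → ℕ → Atom 0 → Set
  ReplCond Repl⁻₁ v P = occA v P ≡ 1
  ReplCond _      v P = ⊤

  HasLW : Weak → Set
  HasLW noLW   = ⊥
  HasLW withLW = ⊤

  -- Derivations in G3[mic]^= (with the chosen Repl variant, optionally
  -- with left weakening) from a set H of open assumption sequents.
  -- `Derivable … H S`: S is derivable with leaves that are initial
  -- sequents, conclusions of zero-premise rules, or members of H.

  data Derivable (L : Logic) (K : ReplKind) (W : Weak)
                 (H : Seq → Set) : Seq → Set where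
    hyp  : ∀ {S} → H S → Derivable L K W H S
    perm : ∀ {Γ Γ' Δ Δ'} → Γ ↭ Γ' → Δ ↭ Δ' →
           Derivable L K W H (Γ ⇒ Δ) → Derivable L K W H (Γ' ⇒ Δ')
    init : ∀ {P Γ Δ} → InitFormula L P → Derivable L K W H (P ∷ Γ ⇒ P ∷ Δ)
    L⊥   : ∀ {Γ Δ} → HasL⊥ L → Derivable L K W H (⊥' ∷ Γ ⇒ Δ)
    L∧   : ∀ {A B Γ Δ} → Derivable L K W H (A ∷ B ∷ Γ ⇒ Δ) →
           Derivable L K W H ((A ∧' B) ∷ Γ ⇒ Δ)
    R∧   : ∀ {A B Γ Δ} → Derivable L K W H (Γ ⇒ A ∷ Δ) →
           Derivable L K W H (Γ ⇒ B ∷ Δ) →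
           Derivable L K W H (Γ ⇒ (A ∧' B) ∷ Δ)
    L∨   : ∀ {A B Γ Δ} → Derivable L K W H (A ∷ Γ ⇒ Δ) →
           Derivable L K W H (B ∷ Γ ⇒ Δ) →
           Derivable L K W H ((A ∨' B) ∷ Γ ⇒ Δ)
    R∨   : ∀ {A B Γ Δ} → Derivable L K W H (Γ ⇒ A ∷ B ∷ Δ) →
           Derivable L K W H (Γ ⇒ (A ∨' B) ∷ Δ)
    L⊃c  : ∀ {A B Γ Δ} → IsClassical L →
           Derivable L K W H (Γ ⇒ A ∷ Δ) →
           Derivable L K W H (B ∷ Γ ⇒ Δ) →
           Derivable L K W H ((A ⊃' B) ∷ Γ ⇒ Δ)
    R⊃c  : ∀ {A B Γ Δ} → IsClassical L →
           Derivable L K W H (A ∷ Γ ⇒ B ∷ Δ) →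
           Derivable L K W H (Γ ⇒ (A ⊃' B) ∷ Δ)
    -- implication, minimal/intuitionistic (multisuccedent, Dragalin style)
    L⊃i  : ∀ {A B Γ Δ} → NonClassical L →
           Derivable L K W H ((A ⊃' B) ∷ Γ ⇒ A ∷ Δ) →
           Derivable L K W H (B ∷ Γ ⇒ Δ) →
           Derivable L K W H ((A ⊃' B) ∷ Γ ⇒ Δ)
    R⊃i  : ∀ {A B Γ Δ} → NonClassical L →
           Derivable L K W H (A ∷ Γ ⇒ B ∷ []) →
           Derivable L K W H (Γ ⇒ (A ⊃' B) ∷ Δ)
    L∀   : ∀ {A Γ Δ} (t : Term 0) →
           Derivable L K W H (inst A t ∷ ∀' A ∷ Γ ⇒ Δ) →
           Derivable L K W H (∀' A ∷ Γ ⇒ Δ)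
    R∀c  : ∀ {A Γ Δ} (y : ℕ) → IsClassical L →
           occL y Γ ≡ 0 → occL y Δ ≡ 0 → occF y A ≡ 0 →
           Derivable L K W H (Γ ⇒ inst A (var y) ∷ Δ) →
           Derivable L K W H (Γ ⇒ ∀' A ∷ Δ)
    R∀i  : ∀ {A Γ Δ} (y : ℕ) → NonClassical L →
           occL y Γ ≡ 0 → occF y A ≡ 0 →
           Derivable L K W H (Γ ⇒ inst A (var y) ∷ []) →
           Derivable L K W H (Γ ⇒ ∀' A ∷ Δ)
    L∃   : ∀ {A Γ Δ} (y : ℕ) →
           occL y Γ ≡ 0 → occL y Δ ≡ 0 → occF y A ≡ 0 →
           Derivable L K W H (inst A (var y) ∷ Γ ⇒ Δ) →
           Derivable L K W H (∃' A ∷ Γ ⇒ Δ)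
    R∃   : ∀ {A Γ Δ} (t : Term 0) →
           Derivable L K W H (Γ ⇒ ∃' A ∷ inst A t ∷ Δ) →
           Derivable L K W H (Γ ⇒ ∃' A ∷ Δ)
    Ref  : ∀ {Γ Δ} (t : Term 0) →
           Derivable L K W H (eqF t t ∷ Γ ⇒ Δ) →
           Derivable L K W H (Γ ⇒ Δ)
    ReplR : ∀ {Γ Δ} (s r : Term 0) (P : Atom 0) (v : ℕ) → IsFull K →
           occT v s ≡ 0 → occT v r ≡ 0 →
           Derivable L K W H
             (eqF s r ∷ atom (P [ v / s ]) ∷ atom (P [ v / r ]) ∷ Γ ⇒ Δ) →
           Derivable L K W H (eqF s r ∷ atom (P [ v / s ]) ∷ Γ ⇒ Δ)
    ReplM : ∀ {Γ Δ} (s r : Term 0) (P : Atom 0) (v : ℕ) → IsMinus K →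
           ReplCond K v P →
           occT v s ≡ 0 → occT v r ≡ 0 →
           Derivable L K W H (eqF s r ∷ atom (P [ v / r ]) ∷ Γ ⇒ Δ) →
           Derivable L K W H (eqF s r ∷ atom (P [ v / s ]) ∷ Γ ⇒ Δ)
    LW   : ∀ {F Γ Δ} → HasLW W →
           Derivable L K W H (Γ ⇒ Δ) →
           Derivable L K W H (F ∷ Γ ⇒ Δ)

module Submission where

-- Both facts follow from one observation: a single Repl⁻ step can rewrite
-- one side of an equation in the antecedent.  Taking the atom P = a ≐ v
-- (resp. v ≐ b) for a variable v fresh for all terms involved, the rule
-- Repl⁻ with principal equation s = r turns  s = r, a = r, Γ ⇒ Δ  into
-- s = r, a = s, Γ ⇒ Δ  (resp.  s = r, r = b, Γ ⇒ Δ  into  s = r, s = b, Γ ⇒ Δ).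
-- Since v occurs exactly once in P, these steps are instances of Repl⁻₁,
-- hence available in both S and S₁.
--   (a) Rewriting the right side of the second copy of s = r yields
--       s = r, s = s, Γ ⇒ Δ, and Ref on s removes s = s.
--   (b) Weakening s = r, Γ ⇒ Δ by r = s and rewriting the left side of
--       s = r with r = s yields r = s, r = r, Γ ⇒ Δ; Ref on r removes r = r.

open import Defs
open import Data.List using (List; _∷_)
open import Data.Product using (_×_; _,_)
open import Data.Vec using (Vec; []; _∷_)
open import Data.Nat using (ℕ; suc; _+_; _≟_; _⊔_; _<_)
open import Data.Nat.Properties using (<-irrefl; m⊔n<o⇒m<o; m⊔n<o⇒n<o; ≤-refl)
open import Data.Unit using (tt)
open import Data.Empty using (⊥-elim)
open import Relation.Nullary using (yes; no)
open import Relation.Binary.PropositionalEquality using (_≡_; refl; cong; cong₂)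
open import Data.List.Relation.Binary.Permutation.Propositional using (swap; ↭-refl)

module EqualityRules (σ : Sig) where

  -- The largest free variable of a closed term (0 if there is none);
  -- every variable above it is fresh for the term.
  mutual
    maxVar : Term σ 0 → ℕ
    maxVar (var x)    = x
    maxVar (bvar ())
    maxVar (fun f ts) = maxVars ts

    maxVars : ∀ {m} → Vec (Term σ 0) m → ℕ
    maxVars []       = 0
    maxVars (t ∷ ts) = maxVar t ⊔ maxVars ts

  mutual
    occT-above : ∀ v (t : Term σ 0) → maxVar t < v → occT σ v t ≡ 0
    occT-above v (var x) x<v with v ≟ x
    ... | yes refl = ⊥-elim (<-irrefl refl x<v)
    ... | no _     = refl
    occT-above v (fun f ts) ts<v = occTs-above v ts ts<v

    occTs-above : ∀ {m} v (ts : Vec (Term σ 0) m) → maxVars ts < v → occTs σ v ts ≡ 0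
    occTs-above v []       _     = refl
    occTs-above v (t ∷ ts) tts<v =
      cong₂ _+_ (occT-above v t (m⊔n<o⇒m<o _ _ tts<v))
                (occTs-above v ts (m⊔n<o⇒n<o _ _ tts<v))

  mutual
    substT-above : ∀ v w (u : Term σ 0) → maxVar u < v → substT σ v w u ≡ u
    substT-above v w (var x) x<v with v ≟ x
    ... | yes refl = ⊥-elim (<-irrefl refl x<v)
    ... | no _     = refl
    substT-above v w (fun f ts) ts<v = cong (fun f) (substTs-above v w ts ts<v)

    substTs-above : ∀ {m} v w (us : Vec (Term σ 0) m) → maxVars us < v →
                    substTs σ v w us ≡ us
    substTs-above v w []       _     = refl
    substTs-above v w (u ∷ us) uus<v =
      cong₂ _∷_ (substT-above v w u (m⊔n<o⇒m<o _ _ uus<v))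
                (substTs-above v w us (m⊔n<o⇒n<o _ _ uus<v))

  substT-self : ∀ v w → substT σ v w (var v) ≡ w
  substT-self v w with v ≟ v
  ... | yes _ = refl
  ... | no v≢v = ⊥-elim (v≢v refl)

  occT-self : ∀ v → occT σ {0} v (var v) ≡ 1
  occT-self v with v ≟ v
  ... | yes _ = refl
  ... | no v≢v = ⊥-elim (v≢v refl)

  record FreshFor (a b c : Term σ 0) : Set where
    field
      name : ℕ
      above₁ : maxVar a < name
      above₂ : maxVar b < name
      above₃ : maxVar c < name

  freshFor : ∀ a b c → FreshFor a b c
  freshFor a b c = record
    { name   = suc (maxVar a ⊔ maxVar b ⊔ maxVar c)
    ; above₁ = m⊔n<o⇒m<o (maxVar a) (maxVar b) ab<v
    ; above₂ = m⊔n<o⇒n<o (maxVar a) (maxVar b) ab<v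
    ; above₃ = m⊔n<o⇒n<o (maxVar a ⊔ maxVar b) (maxVar c) ≤-refl
    }
    where
      ab<v : maxVar a ⊔ maxVar b < suc (maxVar a ⊔ maxVar b ⊔ maxVar c)
      ab<v = m⊔n<o⇒m<o (maxVar a ⊔ maxVar b) (maxVar c) ≤-refl

  singleOccurrenceAllowed : ∀ K → IsMinus K → ∀ v P → occA σ v P ≡ 1 → ReplCond σ K v P
  singleOccurrenceAllowed Repl⁻  _ v P _    = tt
  singleOccurrenceAllowed Repl⁻₁ _ v P once = once

  module _ {L : Logic} {K : ReplKind} {W : Weak} {H : Seq σ → Set} (minus : IsMinus K) where

    private
      D : Seq σ → Set
      D = Derivable σ L K W H

    exchange : ∀ {A B Γ Δ} → D (A ∷ B ∷ Γ ⇒ Δ) → D (B ∷ A ∷ Γ ⇒ Δ)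
    exchange = perm (swap _ _ ↭-refl) ↭-refl

    -- Repl⁻ with a single occurrence of v, stated for atoms that are
    -- given up to the equations computing the two substitution instances.
    replace : ∀ {Γ Δ A B} (s r : Term σ 0) (P : Atom σ 0) (v : ℕ) →
              occA σ v P ≡ 1 → occT σ v s ≡ 0 → occT σ v r ≡ 0 →
              _[_/_] σ P v s ≡ A → _[_/_] σ P v r ≡ B →
              D (eqF σ s r ∷ atom B ∷ Γ ⇒ Δ) → D (eqF σ s r ∷ atom A ∷ Γ ⇒ Δ)
    replace s r P v once s∌v r∌v refl refl =
      ReplM s r P v minus (singleOccurrenceAllowed _ minus v P once) s∌v r∌v

    replaceRight : ∀ {Γ Δ} (s r a : Term σ 0) →
                   D (eqF σ s r ∷ eqF σ a r ∷ Γ ⇒ Δ) → D (eqF σ s r ∷ eqF σ a s ∷ Γ ⇒ Δ)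
    replaceRight s r a =
      replace s r (a ≐ var v) v
        (cong₂ _+_ (occT-above v a above₃) (occT-self v))
        (occT-above v s above₁) (occT-above v r above₂)
        (cong₂ _≐_ (substT-above v s a above₃) (substT-self v s))
        (cong₂ _≐_ (substT-above v r a above₃) (substT-self v r))
      where
        open FreshFor (freshFor s r a) renaming (name to v)

    replaceLeft : ∀ {Γ Δ} (s r b : Term σ 0) →
                  D (eqF σ s r ∷ eqF σ r b ∷ Γ ⇒ Δ) → D (eqF σ s r ∷ eqF σ s b ∷ Γ ⇒ Δ)
    replaceLeft s r b =
      replace s r (var v ≐ b) v
        (cong₂ _+_ (occT-self v) (occT-above v b above₃))
        (occT-above v s above₁) (occT-above v r above₂)
        (cong₂ _≐_ (substT-self v s) (substT-above v s b above₃))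
        (cong₂ _≐_ (substT-self v r) (substT-above v r b above₃))
      where
        open FreshFor (freshFor s r b) renaming (name to v)

    contractEq : ∀ {Γ Δ} (s r : Term σ 0) →
                 D (eqF σ s r ∷ eqF σ s r ∷ Γ ⇒ Δ) → D (eqF σ s r ∷ Γ ⇒ Δ)
    contractEq s r d = Ref s (exchange (replaceRight s r s d))

    symmetryEq : ∀ {Γ Δ} → HasLW σ W → (s r : Term σ 0) →
                 D (eqF σ s r ∷ Γ ⇒ Δ) → D (eqF σ r s ∷ Γ ⇒ Δ)
    symmetryEq lw s r d = Ref r (exchange (replaceLeft r s r (LW lw d)))

lemma4 : (σ : Sig) (L : Logic) →
    ((s r : Term σ 0) (Γ Δ : List (Formula σ 0)) →
      Derivable σ L Repl⁻₁ noLW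
        (λ S → S ≡ (eqF σ s r ∷ eqF σ s r ∷ Γ ⇒ Δ))
        (eqF σ s r ∷ Γ ⇒ Δ))
    × ((s r : Term σ 0) (Γ Δ : List (Formula σ 0)) →
      Derivable σ L Repl⁻₁ withLW
        (λ S → S ≡ (eqF σ s r ∷ Γ ⇒ Δ))
        (eqF σ r s ∷ Γ ⇒ Δ))
    × ((s r : Term σ 0) (Γ Δ : List (Formula σ 0)) →
      Derivable σ L Repl⁻ withLW
        (λ S → S ≡ (eqF σ s r ∷ Γ ⇒ Δ))
        (eqF σ r s ∷ Γ ⇒ Δ))
lemma4 σ L =
    (λ s r _ _ → contractEq tt s r (hyp refl))
  , (λ s r _ _ → symmetryEq tt tt s r (hyp refl))
  , (λ s r _ _ → symmetryEq tt tt s r (hyp refl))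
  where open EqualityRules σ
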